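{- Let $X\in\{\mathrm{K4\times S5},\mathrm{S4\times S5},\mathrm{SSL}\}$, let $\varphi$ be a bimodal formula of length $n$. If $(\mathcal{F}_0,\dots,\mathcal{F}_l)$, $l\geq 0$, is a sequence of $X$-tableau-clouds with respect to $\varphi$ such that during the execution of $\mathit{ALG}_X(\varphi)$ a call $\mathit{alg}_X(\varphi,\mathcal{F}_0,\dots,\mathcal{F}_l)$ occurs, then $l<5\cdot n\cdot|\mathcal{T}^X_\varphi|^2$.
   Context: Bimodal formulas are strings over $\{(,),\neg,\wedge,\Box,K,x,0,1\}$ generated by $\varphi::=\neg\varphi\mid(\varphi\wedge\varphi)\mid K\varphi\mid\Box\varphi\mid A$, with propositional variables $A\in AT$ written as $x$ followed by a binary numeral; the length is the string length. $\mathrm{sf}(\varphi)$ is the set of subformulas; $\mathcal{L}_\Box$ (resp. $\mathcal{L}_K$) is the set of formulas of the form $\Box\chi$ (resp. $K\chi$). A $\mathrm{K4\times S5}$-tableau-set w.r.t. $\varphi$ is $F\subseteq\mathrm{sf}(\varphi)$ with (a) $\neg\chi\in F\iff\chi\notin F$; (b) $(\chi_1\wedge\chi_2)\in F\iff\chi_1,\chi_2\in F$; (c) $K\chi\in F\Rightarrow\chi\in F$ (for formulas in $\mathrm{sf}(\varphi)$); $\mathrm{S4\times S5}$-/$\mathrm{SSL}$-tableau-sets also satisfy (d) $\Box\chi\in F\Rightarrow\chi\in F$. $\mathcal{T}^X_\varphi$ = set of $X$-tableau-sets. An $X$-tableau-cloud is $\mathcal{F}\subseteq\mathcal{T}^X_\varphi$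 with $F\cap\mathcal{L}_K=G\cap\mathcal{L}_K$ for $F,G\in\mathcal{F}$ and, for $K\chi\in\mathrm{sf}(\varphi)$, $\chi\in\bigcap\mathcal{F}\Rightarrow K\chi\in\bigcap\mathcal{F}$. $\mathfrak{C}^X_\varphi$ = set of clouds. $F\preccurlyeq_X G$: for $\mathrm{K4\times S5}$, $F\cap\mathcal{L}_\Box\subseteq G$ and $\{\psi:\Box\psi\in F\}\subseteq G$; for $\mathrm{S4\times S5}$, $F\cap\mathcal{L}_\Box\subseteq G$; for $\mathrm{SSL}$, $F\cap\mathcal{L}_\Box\subseteq G$ and $F\cap AT=G\cap AT$. $\mathcal{F}\leq_X\mathcal{G}$: every $G\in\mathcal{G}$ has $F\in\mathcal{F}$ with $F\preccurlyeq_X G$, and (only for $X\neq\mathrm{SSL}$) every $F\in\mathcal{F}$ has $G\in\mathcal{G}$ with $F\preccurlyeq_X G$. Procedure $\mathit{alg}_X(\varphi,\mathcal{F}_0,\dots,\mathcal{F}_m)$ (for pairwise different clouds with $\mathcal{F}_i\leq_X\mathcal{F}_{i+1}$): for every $(\Box\chi,F)\in\mathrm{sf}(\varphi)\times\mathcal{F}_m$ with $\Box\chi\notin F$ it checks (I) whether some $i\leq m$ has $\mathcal{F}_m\leq_X\mathcal{F}_i$ and some $G\in\mathcal{F}_i$ with $F\preccurlyeq_X G$, $\chi\notin G$; if not, (II) whether some $\mathcal{F}_{m+1}\in\mathfrak{C}^X_\varphi\setminus\{\mathcal{F}_0,\dots,\mathcal{F}_m\}$ with $\mathcal{F}_m\leq_X\mathcal{F}_{m+1}$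 contains $G$ with $F\preccurlyeq_X G$, $\chi\notin G$, and the recursive call $\mathit{alg}_X(\varphi,\mathcal{F}_0,\dots,\mathcal{F}_{m+1})$ returns ``yes''. It returns ``yes'' iff every such pair satisfies (I) or (II). Algorithm $\mathit{ALG}_X(\varphi)$: runs through all $\mathcal{F}_0\in\mathfrak{C}^X_\varphi$ containing some $F$ with $\varphi\in F$ and calls $\mathit{alg}_X(\varphi,\mathcal{F}_0)$; it accepts iff some such call returns ``yes''. -}

module Defs where

open import Data.Bool using (Bool; true; false; _∧_; _∨_; not; T)
open import Data.Nat using (ℕ; zero; suc; _+_)
open import Data.List using (List; []; _∷_; _++_; map; length; deduplicateᵇ; filterᵇ)
open import Data.Bool.ListAction using (and; or)
open import Data.List.NonEmpty using (List⁺) renaming (length to length⁺; toList to toList⁺)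
open import Data.List.Membership.Propositional using (_∈_)
open import Data.Vec using (Vec; []; _∷_; fromList; toList; zipWith; last; lookup; _∷ʳ_)
open import Data.Fin using (Fin)
open import Data.Product using (Σ; ∃; _×_; _,_)
open import Relation.Nullary using (¬_)
open import Relation.Binary.PropositionalEquality using (_≡_)

-- Bimodal formulas.  A propositional variable is written x followed by a
-- (nonempty) binary numeral; we store the numeral as a nonempty list of bits.

data Fm : Set where
  var  : List⁺ Bool → Fm
  ¬'_  : Fm → Fm
  _∧'_ : Fm → Fm → Fm
  K    : Fm → Fm
  □    : Fm → Fm

-- string length of a formula over {(,),¬,∧,□,K,x,0,1}
len : Fm → ℕ
len (var b)  = 1 + length⁺ b
len (¬' a)   = 1 + len a
len (a ∧' b) = 3 + len a + len b
len (K a)    = 1 + len a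
len (□ a)    = 1 + len a

eqBool : Bool → Bool → Bool
eqBool true  b = b
eqBool false b = not b

eqBits : List Bool → List Bool → Bool
eqBits []       []       = true
eqBits (x ∷ xs) (y ∷ ys) = eqBool x y ∧ eqBits xs ys
eqBits _        _        = false

_==_ : Fm → Fm → Bool
var a    == var b    = eqBits (toList⁺ a) (toList⁺ b)
(¬' a)   == (¬' b)   = a == b
(a ∧' b) == (c ∧' d) = (a == c) ∧ (b == d)
K a      == K b      = a == b
□ a      == □ b      = a == b
_        == _        = false

sfRaw : Fm → List Fm
sfRaw (var a)  = var a ∷ []
sfRaw (¬' a)   = (¬' a) ∷ sfRaw a
sfRaw (a ∧' b) = (a ∧' b) ∷ sfRaw a ++ sfRaw b
sfRaw (K a)    = K a ∷ sfRaw a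
sfRaw (□ a)    = □ a ∷ sfRaw a

sf : Fm → List Fm
sf φ = deduplicateᵇ _==_ (sfRaw φ)

sfV : (φ : Fm) → Vec Fm (length (sf φ))
sfV φ = fromList (sf φ)

-- A subset of sf(φ), given by its characteristic vector (indexed like sf φ).
SubF : Fm → Set
SubF φ = Vec Bool (length (sf φ))

memb : (φ : Fm) → Fm → SubF φ → Bool
memb φ χ F = or (toList (zipWith (λ ψ b → (ψ == χ) ∧ b) (sfV φ) F))

_∈[_]_ : Fm → (φ : Fm) → SubF φ → Set
χ ∈[ φ ] F = T (memb φ χ F)

data Logic : Set where
  K4xS5 S4xS5 SSL : Logic

iffᵇ : Bool → Bool → Bool
iffᵇ b c = (b ∧ c) ∨ (not b ∧ not c)

cond : Logic → (φ : Fm) → SubF φ → Fm → Bool → Bool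
cond X     φ F (var a)    b = true
cond X     φ F (¬' χ)     b = iffᵇ b (not (memb φ χ F))
cond X     φ F (χ₁ ∧' χ₂) b = iffᵇ b (memb φ χ₁ F ∧ memb φ χ₂ F)
cond X     φ F (K χ)      b = not b ∨ memb φ χ F
cond K4xS5 φ F (□ χ)      b = true
cond S4xS5 φ F (□ χ)      b = not b ∨ memb φ χ F
cond SSL   φ F (□ χ)      b = not b ∨ memb φ χ F

isTab : (X : Logic) (φ : Fm) → SubF φ → Bool
isTab X φ F = and (toList (zipWith (cond X φ F) (sfV φ) F))

IsTab : (X : Logic) (φ : Fm) → SubF φ → Set
IsTab X φ F = T (isTab X φ F)

allVec : (n : ℕ) → List (Vec Bool n)
allVec zero    = [] ∷ []
allVec (suc n) = map (true ∷_) (allVec n) ++ map (false ∷_) (allVec n)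

numTab : Logic → Fm → ℕ
numTab X φ = length (filterᵇ (isTab X φ) (allVec (length (sf φ))))

-- Clouds: sets of subsets of sf(φ), as characteristic functions.

Cloud : Fm → Set
Cloud φ = SubF φ → Bool

InC : (φ : Fm) → SubF φ → Cloud φ → Set
InC φ F 𝓕 = T (𝓕 F)

syntax InC φ F 𝓕 = F ∈ᶜ[ φ ] 𝓕

CEq : (φ : Fm) → Cloud φ → Cloud φ → Set
CEq φ 𝓕 𝓖 = ∀ (F : SubF φ) → 𝓕 F ≡ 𝓖 F

IsCloud : (X : Logic) (φ : Fm) → Cloud φ → Set
IsCloud X φ 𝓕 =
  (∀ F → F ∈ᶜ[ φ ] 𝓕 → IsTab X φ F)
  × (∀ F G → F ∈ᶜ[ φ ] 𝓕 → G ∈ᶜ[ φ ] 𝓕 → ∀ χ →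
       (K χ ∈[ φ ] F → K χ ∈[ φ ] G) × (K χ ∈[ φ ] G → K χ ∈[ φ ] F))
  × (∀ χ → K χ ∈ sf φ → (∀ F → F ∈ᶜ[ φ ] 𝓕 → χ ∈[ φ ] F) →
       (∀ F → F ∈ᶜ[ φ ] 𝓕 → K χ ∈[ φ ] F))

Prec : (X : Logic) (φ : Fm) → SubF φ → SubF φ → Set
Prec K4xS5 φ F G = ∀ χ → □ χ ∈[ φ ] F → □ χ ∈[ φ ] G × χ ∈[ φ ] G
Prec S4xS5 φ F G = ∀ χ → □ χ ∈[ φ ] F → □ χ ∈[ φ ] G
Prec SSL   φ F G = (∀ χ → □ χ ∈[ φ ] F → □ χ ∈[ φ ] G)
  × (∀ a → (var a ∈[ φ ] F → var a ∈[ φ ] G) × (var a ∈[ φ ] G → var a ∈[ φ ] F))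

CLe : (X : Logic) (φ : Fm) → Cloud φ → Cloud φ → Set
CLe SSL φ 𝓕 𝓖 = ∀ G → G ∈ᶜ[ φ ] 𝓖 → ∃ λ F → F ∈ᶜ[ φ ] 𝓕 × Prec SSL φ F G
CLe X   φ 𝓕 𝓖 = (∀ G → G ∈ᶜ[ φ ] 𝓖 → ∃ λ F → F ∈ᶜ[ φ ] 𝓕 × Prec X φ F G)
              × (∀ F → F ∈ᶜ[ φ ] 𝓕 → ∃ λ G → G ∈ᶜ[ φ ] 𝓖 × Prec X φ F G)

-- AlgCall X φ l s  means: a call alg_X(φ, s[0], …, s[l]) occurs.
-- (Over-approximation w.r.t. evaluation order: every call that can be issued
-- under some order of exploring pairs / candidate clouds is included.)

data AlgCall (X : Logic) (φ : Fm) : (l : ℕ) → Vec (Cloud φ) (suc l) → Set where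
  start : (𝓕₀ : Cloud φ) → IsCloud X φ 𝓕₀ →
          (∃ λ F → F ∈ᶜ[ φ ] 𝓕₀ × φ ∈[ φ ] F) →
          AlgCall X φ zero (𝓕₀ ∷ [])
  -- alg_X(φ, 𝓕₀..𝓕ₘ) calls alg_X(φ, 𝓕₀..𝓕ₘ₊₁) in step (II) for a pair (□χ, F)
  step : ∀ {m} (s : Vec (Cloud φ) (suc m)) → AlgCall X φ m s →
         (χ : Fm) (F : SubF φ) →
         □ χ ∈ sf φ → F ∈ᶜ[ φ ] last s → ¬ (□ χ ∈[ φ ] F) →
         -- (I) fails for (□χ, F)
         ¬ (∃ λ (i : Fin (suc m)) → (CLe X φ (last s) (lookup s i)) ×
              ∃ λ G → G ∈ᶜ[ φ ] lookup s i × Prec X φ F G × ¬ (χ ∈[ φ ] G)) →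
         (𝓕' : Cloud φ) → IsCloud X φ 𝓕' →
         (∀ i → ¬ CEq φ 𝓕' (lookup s i)) →
         CLe X φ (last s) 𝓕' →
         (∃ λ G → G ∈ᶜ[ φ ] 𝓕' × Prec X φ F G × ¬ (χ ∈[ φ ] G)) →
         AlgCall X φ (suc m) (s ∷ʳ 𝓕')

module Submission where

-- Write N = |sf φ|.  In a call chain each depth j < l was reached by step (II) for a
-- pair (□χ_j, F_j), F_j ∈ 𝓕_j, whose test (I) failed.  Let U(𝓒) be the set of
-- tableau-sets ≼_X-above a member of 𝓒 and L(𝓒) those ≼_X-below a member of 𝓒
-- (L = ∅ for SSL, whose ≤_X has no downward clause).  Since ≼_X is transitive,
-- U(𝓕_j) shrinks and L(𝓕_{j+1}) grows with j, so the potential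
--   |U(𝓕_j)| + (T − |L(𝓕_{j+1})|) ∈ {0, …, 2T}
-- is non-increasing and unchanged only while both sets are unchanged.  If j < k shared
-- the potential, the box □χ and the set F, then 𝓕_k ≤_X 𝓕_{j+1}, and the witness
-- G_j ∈ 𝓕_{j+1} of step j would have passed test (I) at step k.  So depth ↦
-- (potential, □χ, F) is injective and l ≤ (2T+1)·N·T < 5·n·T², as N ≤ n and T ≥ 1.

open import Defs
open import Data.Bool using (Bool; true; false; _∧_; _∨_; not; T)
open import Data.Bool.Properties using (T-∧; T-∨)
open import Data.Bool.ListAction using (or; any; all)
open import Data.Nat using (ℕ; zero; suc; _+_; _*_; _∸_; _^_; _≤_; _<_; _≤′_; ≤′-refl; ≤′-step; z≤n; s≤s; s≤s⁻¹)
open import Data.Nat.Properties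
open import Data.Nat.Tactic.RingSolver using (solve-∀)
open import Data.List using (List; []; _∷_; _++_; map; length; filterᵇ)
import Data.List as List
open import Data.List.Properties using (length-++; length-deduplicate)
open import Data.List.NonEmpty using (List⁺; _∷_) renaming (toList to toList⁺)
open import Data.List.Membership.Propositional using (_∈_; lose)
open import Data.List.Membership.Propositional.Properties using (∈-++⁺ˡ; ∈-++⁺ʳ; ∈-map⁺; ∈-filter⁺; ∈-filter⁻; ∈-length)
open import Data.List.Relation.Unary.Any using (here; there; satisfied; index)
open import Data.List.Relation.Unary.Any.Properties using (any⁺; any⁻; lookup-index)
open import Data.List.Relation.Unary.All as All using ()
open import Data.List.Relation.Unary.All.Properties using (all⁺; all⁻)
open import Data.List.Relation.Binary.Sublist.Propositional using (_⊆_; ⊆-refl)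
open import Data.List.Relation.Binary.Sublist.Propositional.Properties using (filter⁺; length-mono-≤; to-≋)
open import Data.List.Relation.Binary.Pointwise using (Pointwise-≡⇒≡)
open import Data.Vec using (Vec; []; _∷_; fromList; toList; zipWith; lookup; last; _∷ʳ_)
open import Data.Fin using (Fin; toℕ; fromℕ<; combine)
open import Data.Fin.Properties using (toℕ<n; toℕ-fromℕ<; toℕ-injective; combine-injective; injective⇒≤)
open import Data.Product using (∃; _×_; _,_; proj₁; proj₂)
open import Data.Sum using (inj₁; inj₂)
open import Data.Unit using (⊤; tt)
open import Data.Empty using (⊥; ⊥-elim)
open import Function using (_∘_; _⇔_; mk⇔; Equivalence)
open import Relation.Nullary using (¬_)
open import Relation.Nullary.Decidable using (T?)
open import Relation.Binary.Definitions using (tri<; tri≈; tri>)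
open import Relation.Binary.PropositionalEquality

eqBool-sound : ∀ a b → T (eqBool a b) → a ≡ b
eqBool-sound true  true  _ = refl
eqBool-sound false false _ = refl

eqBits-sound : ∀ xs ys → T (eqBits xs ys) → xs ≡ ys
eqBits-sound []       []       _ = refl
eqBits-sound (x ∷ xs) (y ∷ ys) h with Equivalence.to T-∧ h
... | x≡y , xs≡ys = cong₂ _∷_ (eqBool-sound x y x≡y) (eqBits-sound xs ys xs≡ys)

toList⁺-injective : ∀ (a b : List⁺ Bool) → toList⁺ a ≡ toList⁺ b → a ≡ b
toList⁺-injective (x ∷ xs) (.x ∷ .xs) refl = refl

==-sound : ∀ a b → T (a == b) → a ≡ b
==-sound (var a)  (var b)  h = cong var (toList⁺-injective a b (eqBits-sound _ _ h))
==-sound (¬' a)   (¬' b)   h = cong ¬'_ (==-sound a b h)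
==-sound (a ∧' b) (c ∧' d) h with Equivalence.to T-∧ h
... | a≡c , b≡d = cong₂ _∧'_ (==-sound a c a≡c) (==-sound b d b≡d)
==-sound (K a)    (K b)    h = cong K (==-sound a b h)
==-sound (□ a)    (□ b)    h = cong □ (==-sound a b h)

marked⇒∈ : ∀ ψ (xs : List Fm) (F : Vec Bool (length xs)) →
  T (or (toList (zipWith (λ ψ' b → (ψ' == ψ) ∧ b) (fromList xs) F))) → ψ ∈ xs
marked⇒∈ ψ []       []      ()
marked⇒∈ ψ (x ∷ xs) (b ∷ F) h with Equivalence.to T-∨ h
... | inj₁ marked = here (sym (==-sound x ψ (proj₁ (Equivalence.to T-∧ marked))))
... | inj₂ later  = there (marked⇒∈ ψ xs F later)

∈[]⇒∈sf : ∀ φ ψ (F : SubF φ) → ψ ∈[ φ ] F → ψ ∈ sf φ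
∈[]⇒∈sf φ ψ = marked⇒∈ ψ (sf φ)

allVec-complete : ∀ {n} (v : Vec Bool n) → v ∈ allVec n
allVec-complete []                  = here refl
allVec-complete {suc n} (true ∷ v)  = ∈-++⁺ˡ (∈-map⁺ (true ∷_) (allVec-complete v))
allVec-complete {suc n} (false ∷ v) =
  ∈-++⁺ʳ (map (true ∷_) (allVec n)) (∈-map⁺ (false ∷_) (allVec-complete v))

any-allVec : ∀ {n} (p : Vec Bool n → Bool) → T (any p (allVec n)) ⇔ (∃ λ v → T (p v))
any-allVec {n} p = mk⇔ (satisfied ∘ any⁻ p (allVec n)) (λ (v , pv) → any⁺ p (lose (allVec-complete v) pv))

count : ∀ {A : Set} → (A → Bool) → List A → ℕ
count p xs = length (filterᵇ p xs)

module _ {A : Set} {p q : A → Bool} (p⇒q : ∀ x → T (p x) → T (q x)) where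

  filter-sublist : ∀ xs → filterᵇ p xs ⊆ filterᵇ q xs
  filter-sublist xs = filter⁺ (T? ∘ p) (T? ∘ q) (λ { refl → p⇒q _ }) (⊆-refl {x = xs})

  count-mono : ∀ xs → count p xs ≤ count q xs
  count-mono xs = length-mono-≤ (filter-sublist xs)

  count-stable : ∀ xs → count q xs ≤ count p xs → ∀ x → x ∈ xs → T (q x) → T (p x)
  count-stable xs q≤p x x∈xs qx =
    proj₂ (∈-filter⁻ (T? ∘ p) {xs = xs} (subst (x ∈_) (sym same) (∈-filter⁺ (T? ∘ q) {xs = xs} x∈xs qx)))
    where
    same : filterᵇ p xs ≡ filterᵇ q xs
    same = Pointwise-≡⇒≡ (to-≋ (≤-antisym (count-mono xs) q≤p) (filter-sublist xs))

implies-intro : ∀ {b c} → (T b → T c) → T (not b ∨ c)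
implies-intro {true}  b⇒c = b⇒c _
implies-intro {false} _   = _

implies-elim : ∀ {b c} → T (not b ∨ c) → T b → T c
implies-elim {true} c _ = c

iffᵇ-intro : ∀ {b c} → (T b → T c) × (T c → T b) → T (iffᵇ b c)
iffᵇ-intro {true}  {true}  _         = _
iffᵇ-intro {true}  {false} (b⇒c , _) = b⇒c _
iffᵇ-intro {false} {true}  (_ , c⇒b) = c⇒b _
iffᵇ-intro {false} {false} _         = _

iffᵇ-elim : ∀ {b c} → T (iffᵇ b c) → (T b → T c) × (T c → T b)
iffᵇ-elim {true}  {true}  _ = _ , _
iffᵇ-elim {false} {false} _ = (λ ()) , (λ ())

module Closures (φ : Fm) where

  N : ℕ
  N = length (sf φ)

  mb : Fm → SubF φ → Bool
  mb ψ F = memb φ ψ F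

  Kept : Logic → SubF φ → Fm → Set
  Kept K4xS5 G χ = □ χ ∈[ φ ] G × χ ∈[ φ ] G
  Kept _     G χ = □ χ ∈[ φ ] G

  keptᵇ : Logic → SubF φ → Fm → Bool
  keptᵇ K4xS5 G χ = mb (□ χ) G ∧ mb χ G
  keptᵇ _     G χ = mb (□ χ) G

  kept-sound : ∀ X G χ → T (keptᵇ X G χ) → Kept X G χ
  kept-sound K4xS5 G χ = Equivalence.to T-∧
  kept-sound S4xS5 G χ k = k
  kept-sound SSL   G χ k = k

  kept-complete : ∀ X G χ → Kept X G χ → T (keptᵇ X G χ)
  kept-complete K4xS5 G χ = Equivalence.from T-∧
  kept-complete S4xS5 G χ k = k
  kept-complete SSL   G χ k = k

  BoxesKept : Logic → SubF φ → SubF φ → Set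
  BoxesKept X F G = ∀ χ → □ χ ∈[ φ ] F → Kept X G χ

  boxes-kept : ∀ X {F G} → Prec X φ F G → BoxesKept X F G
  boxes-kept K4xS5 F≼G = F≼G
  boxes-kept S4xS5 F≼G = F≼G
  boxes-kept SSL   F≼G = proj₁ F≼G

  localᵇ : Logic → SubF φ → SubF φ → Fm → Bool
  localᵇ X   F G (□ χ)   = not (mb (□ χ) F) ∨ keptᵇ X G χ
  localᵇ SSL F G (var a) = iffᵇ (mb (var a) F) (mb (var a) G)
  localᵇ _   _ _ _       = true

  prec⇒local : ∀ X F G → Prec X φ F G → ∀ ψ → T (localᵇ X F G ψ)
  prec⇒local X     F G F≼G (□ χ)    =
    implies-intro (kept-complete X G χ ∘ boxes-kept X F≼G χ)
  prec⇒local SSL   F G F≼G (var a)  = iffᵇ-intro (proj₂ F≼G a)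
  prec⇒local K4xS5 F G F≼G (var a)  = _
  prec⇒local S4xS5 F G F≼G (var a)  = _
  prec⇒local X     F G F≼G (¬' ψ)   = _
  prec⇒local X     F G F≼G (ψ ∧' ϑ) = _
  prec⇒local X     F G F≼G (K ψ)    = _

  -- Conversely, only subformulas of φ are tested, as members of F and G lie in sf φ.
  local⇒boxes : ∀ X F G → (∀ ψ → ψ ∈ sf φ → T (localᵇ X F G ψ)) → BoxesKept X F G
  local⇒boxes X F G local χ □χ∈F =
    kept-sound X G χ (implies-elim (local (□ χ) (∈[]⇒∈sf φ (□ χ) F □χ∈F)) □χ∈F)

  local⇒prec : ∀ X F G → (∀ ψ → ψ ∈ sf φ → T (localᵇ X F G ψ)) → Prec X φ F G
  local⇒prec K4xS5 F G local = local⇒boxes K4xS5 F G local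
  local⇒prec S4xS5 F G local = local⇒boxes S4xS5 F G local
  local⇒prec SSL   F G local = local⇒boxes SSL F G local , λ a →
    (λ a∈F → proj₁ (iffᵇ-elim (local (var a) (∈[]⇒∈sf φ (var a) F a∈F))) a∈F) ,
    (λ a∈G → proj₂ (iffᵇ-elim (local (var a) (∈[]⇒∈sf φ (var a) G a∈G))) a∈G)

  precᵇ : Logic → SubF φ → SubF φ → Bool
  precᵇ X F G = all (localᵇ X F G) (sf φ)

  precᵇ⇔prec : ∀ X F G → T (precᵇ X F G) ⇔ Prec X φ F G
  precᵇ⇔prec X F G = mk⇔
    (λ h → local⇒prec X F G (λ ψ → All.lookup (all⁺ (localᵇ X F G) (sf φ) h)))
    (λ F≼G → all⁻ (localᵇ X F G) {sf φ} (All.tabulate λ {ψ} _ → prec⇒local X F G F≼G ψ))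

  -- ≼_X is transitive; this is what makes the closures below monotone along a chain.
  prec-trans : ∀ X {F G H} → Prec X φ F G → Prec X φ G H → Prec X φ F H
  prec-trans K4xS5 F≼G G≼H χ □χ∈F = G≼H χ (proj₁ (F≼G χ □χ∈F))
  prec-trans S4xS5 F≼G G≼H χ □χ∈F = G≼H χ (F≼G χ □χ∈F)
  prec-trans SSL   (F≼G , F≈G) (G≼H , G≈H) =
    (λ χ → G≼H χ ∘ F≼G χ) ,
    λ a → (proj₁ (G≈H a) ∘ proj₁ (F≈G a)) , (proj₂ (F≈G a) ∘ proj₂ (G≈H a))

  linked : Logic → Cloud φ → (SubF φ → Bool) → SubF φ → Bool
  linked X 𝓒 r H = isTab X φ H ∧ any (λ F → 𝓒 F ∧ r F) (allVec N)

  linked-intro : ∀ X 𝓒 r {H} F → IsTab X φ H → F ∈ᶜ[ φ ] 𝓒 → T (r F) → T (linked X 𝓒 r H)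
  linked-intro X 𝓒 r F H-tab F∈𝓒 rF = Equivalence.from T-∧
    (H-tab , Equivalence.from (any-allVec _) (F , Equivalence.from T-∧ (F∈𝓒 , rF)))

  linked-elim : ∀ X 𝓒 r {H} → T (linked X 𝓒 r H) → ∃ λ F → F ∈ᶜ[ φ ] 𝓒 × T (r F)
  linked-elim X 𝓒 r {H} h with Equivalence.to (any-allVec _) (proj₂ (Equivalence.to (T-∧ {isTab X φ H}) h))
  ... | F , F-ok = F , Equivalence.to T-∧ F-ok

  linked-tab : ∀ X 𝓒 r {H} → T (linked X 𝓒 r H) → IsTab X φ H
  linked-tab X 𝓒 r = proj₁ ∘ Equivalence.to T-∧

  U : Logic → Cloud φ → SubF φ → Bool
  U X 𝓒 H = linked X 𝓒 (λ F → precᵇ X F H) H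

  U-intro : ∀ X 𝓒 {H} F → IsTab X φ H → F ∈ᶜ[ φ ] 𝓒 → Prec X φ F H → T (U X 𝓒 H)
  U-intro X 𝓒 {H} F H-tab F∈𝓒 F≼H =
    linked-intro X 𝓒 _ F H-tab F∈𝓒 (Equivalence.from (precᵇ⇔prec X F H) F≼H)

  U-elim : ∀ X 𝓒 {H} → T (U X 𝓒 H) → ∃ λ F → F ∈ᶜ[ φ ] 𝓒 × Prec X φ F H
  U-elim X 𝓒 {H} h with linked-elim X 𝓒 _ h
  ... | F , F∈𝓒 , F≼ᵇH = F , F∈𝓒 , Equivalence.to (precᵇ⇔prec X F H) F≼ᵇH

  U-tab : ∀ X 𝓒 {H} → T (U X 𝓒 H) → IsTab X φ H
  U-tab X 𝓒 = linked-tab X 𝓒 _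

  below : Logic → Cloud φ → SubF φ → Bool
  below X 𝓒 F = linked X 𝓒 (λ G → precᵇ X F G) F

  below-intro : ∀ X 𝓒 {F} G → IsTab X φ F → G ∈ᶜ[ φ ] 𝓒 → Prec X φ F G → T (below X 𝓒 F)
  below-intro X 𝓒 {F} G F-tab G∈𝓒 F≼G =
    linked-intro X 𝓒 _ G F-tab G∈𝓒 (Equivalence.from (precᵇ⇔prec X F G) F≼G)

  below-elim : ∀ X 𝓒 {F} → T (below X 𝓒 F) → ∃ λ G → G ∈ᶜ[ φ ] 𝓒 × Prec X φ F G
  below-elim X 𝓒 {F} h with linked-elim X 𝓒 _ h
  ... | G , G∈𝓒 , F≼ᵇG = G , G∈𝓒 , Equivalence.to (precᵇ⇔prec X F G) F≼ᵇG

  hasDownClause : Logic → Bool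
  hasDownClause SSL = false
  hasDownClause _   = true

  L : Logic → Cloud φ → SubF φ → Bool
  L X 𝓒 F = hasDownClause X ∧ below X 𝓒 F

  L-tab : ∀ X 𝓒 {F} → T (L X 𝓒 F) → IsTab X φ F
  L-tab X 𝓒 = linked-tab X 𝓒 _ ∘ proj₂ ∘ Equivalence.to (T-∧ {hasDownClause X})

  Covers : Logic → Cloud φ → Cloud φ → Set
  Covers X 𝓐 𝓑 = ∀ G → G ∈ᶜ[ φ ] 𝓑 → ∃ λ F → F ∈ᶜ[ φ ] 𝓐 × Prec X φ F G

  Dominates : Logic → Cloud φ → Cloud φ → Set
  Dominates X 𝓐 𝓑 = ∀ F → F ∈ᶜ[ φ ] 𝓐 → ∃ λ G → G ∈ᶜ[ φ ] 𝓑 × Prec X φ F G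

  DownClause : Logic → Cloud φ → Cloud φ → Set
  DownClause SSL 𝓐 𝓑 = ⊤
  DownClause X   𝓐 𝓑 = Dominates X 𝓐 𝓑

  ≤⇒covers : ∀ X {𝓐 𝓑} → CLe X φ 𝓐 𝓑 → Covers X 𝓐 𝓑
  ≤⇒covers K4xS5 = proj₁
  ≤⇒covers S4xS5 = proj₁
  ≤⇒covers SSL   𝓐≤𝓑 = 𝓐≤𝓑

  ≤⇒downClause : ∀ X {𝓐 𝓑} → CLe X φ 𝓐 𝓑 → DownClause X 𝓐 𝓑
  ≤⇒downClause K4xS5 = proj₂
  ≤⇒downClause S4xS5 = proj₂
  ≤⇒downClause SSL   _ = tt

  covers-downClause⇒≤ : ∀ X {𝓐 𝓑} → Covers X 𝓐 𝓑 → DownClause X 𝓐 𝓑 → CLe X φ 𝓐 𝓑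
  covers-downClause⇒≤ K4xS5 cov dom = cov , dom
  covers-downClause⇒≤ S4xS5 cov dom = cov , dom
  covers-downClause⇒≤ SSL   cov _   = cov

  U-antitone : ∀ X {𝓐 𝓑} → Covers X 𝓐 𝓑 → ∀ H → T (U X 𝓑 H) → T (U X 𝓐 H)
  U-antitone X {𝓐} {𝓑} cov H H∈U with U-elim X 𝓑 H∈U
  ... | G , G∈𝓑 , G≼H with cov G G∈𝓑
  ... | F , F∈𝓐 , F≼G = U-intro X 𝓐 F (U-tab X 𝓑 H∈U) F∈𝓐 (prec-trans X F≼G G≼H)

  below-monotone : ∀ X {𝓐 𝓑} → Dominates X 𝓐 𝓑 → ∀ F → T (below X 𝓐 F) → T (below X 𝓑 F)
  below-monotone X {𝓐} {𝓑} dom F F-below with below-elim X 𝓐 F-below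
  ... | G , G∈𝓐 , F≼G with dom G G∈𝓐
  ... | H , H∈𝓑 , G≼H = below-intro X 𝓑 H (linked-tab X 𝓐 _ F-below) H∈𝓑 (prec-trans X F≼G G≼H)

  L-monotone : ∀ X {𝓐 𝓑} → DownClause X 𝓐 𝓑 → ∀ F → T (L X 𝓐 F) → T (L X 𝓑 F)
  L-monotone K4xS5 = below-monotone K4xS5
  L-monotone S4xS5 = below-monotone S4xS5
  L-monotone SSL _ F ()

  covered⇒U : ∀ X {𝓐 𝓑} → Covers X 𝓐 𝓑 → ∀ G → G ∈ᶜ[ φ ] 𝓑 → IsTab X φ G → T (U X 𝓐 G)
  covered⇒U X {𝓐} cov G G∈𝓑 G-tab with cov G G∈𝓑
  ... | F , F∈𝓐 , F≼G = U-intro X 𝓐 F G-tab F∈𝓐 F≼G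

  U⇒covered : ∀ X {𝓐 𝓑} → (∀ G → G ∈ᶜ[ φ ] 𝓑 → T (U X 𝓐 G)) → Covers X 𝓐 𝓑
  U⇒covered X {𝓐} 𝓑⊆U G G∈𝓑 = U-elim X 𝓐 (𝓑⊆U G G∈𝓑)

  dominates-transfer : ∀ X {𝓐 𝓑 𝓑'} → Dominates X 𝓐 𝓑 → (∀ F → F ∈ᶜ[ φ ] 𝓐 → IsTab X φ F) →
    (∀ F → T (below X 𝓑 F) → T (below X 𝓑' F)) → Dominates X 𝓐 𝓑'
  dominates-transfer X {𝓑 = 𝓑} {𝓑'} dom 𝓐-tab shift F F∈𝓐 with dom F F∈𝓐
  ... | G , G∈𝓑 , F≼G = below-elim X 𝓑' (shift F (below-intro X 𝓑 G (𝓐-tab F F∈𝓐) G∈𝓑 F≼G))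

  downClause-transfer : ∀ X {𝓐 𝓑 𝓑'} → DownClause X 𝓐 𝓑 → (∀ F → F ∈ᶜ[ φ ] 𝓐 → IsTab X φ F) →
    (∀ F → T (L X 𝓑 F) → T (L X 𝓑' F)) → DownClause X 𝓐 𝓑'
  downClause-transfer K4xS5 = dominates-transfer K4xS5
  downClause-transfer S4xS5 = dominates-transfer S4xS5
  downClause-transfer SSL _ _ _ = tt

index-injective : ∀ {A : Set} {xs : List A} {x y} (p : x ∈ xs) (q : y ∈ xs) → index p ≡ index q → x ≡ y
index-injective {xs = xs} p q i≡j =
  trans (lookup-index p) (trans (cong (List.lookup xs) i≡j) (sym (lookup-index q)))

□-injective : ∀ {a b} → □ a ≡ □ b → a ≡ b
□-injective refl = refl

sum-balanced : ∀ {a b a' b'} → a' ≤ a → b' ≤ b → a + b ≡ a' + b' → a ≤ a' × b ≤ b'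
sum-balanced {a} {b} {a'} {b'} a'≤a b'≤b eq =
  +-cancelʳ-≤ b a a' (subst (_≤ a' + b) (sym eq) (+-monoʳ-≤ a' b'≤b)) ,
  +-cancelˡ-≤ a b b' (subst (_≤ a + b') (sym eq) (+-monoˡ-≤ b' a'≤a))

module Chains (X : Logic) (φ : Fm) where
  open Closures φ

  record Step (C : ℕ → Cloud φ) (j : ℕ) : Set where
    field
      χ           : Fm
      F G         : SubF φ
      □χ∈sf       : □ χ ∈ sf φ
      F∈C         : F ∈ᶜ[ φ ] C j
      testI-fails : ∀ i → i ≤ j → CLe X φ (C j) (C i) →
                    ∀ G' → G' ∈ᶜ[ φ ] C i → Prec X φ F G' → ¬ ¬ (χ ∈[ φ ] G')
      C≤C         : CLe X φ (C j) (C (suc j))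
      G∈C         : G ∈ᶜ[ φ ] C (suc j)
      F≼G         : Prec X φ F G
      χ∉G         : ¬ (χ ∈[ φ ] G)

  record Chain (l : ℕ) (C : ℕ → Cloud φ) : Set where
    field
      tableaux : ∀ i → i ≤ l → ∀ F → F ∈ᶜ[ φ ] C i → IsTab X φ F
      initial  : ∃ λ F → F ∈ᶜ[ φ ] C 0
      steps    : ∀ j → j < l → Step C j

  Tabs : List (SubF φ)
  Tabs = filterᵇ (isTab X φ) (allVec N)

  Tn : ℕ
  Tn = numTab X φ

  tab∈Tabs : ∀ {F} → IsTab X φ F → F ∈ Tabs
  tab∈Tabs {F} F-tab = ∈-filter⁺ (λ H → T? (isTab X φ H)) (allVec-complete F) F-tab

  count≤Tn : ∀ (p : SubF φ → Bool) → (∀ F → T (p F) → IsTab X φ F) → count p (allVec N) ≤ Tn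
  count≤Tn p p⇒tab = count-mono p⇒tab (allVec N)

  module Bound {l : ℕ} {C : ℕ → Cloud φ} (chain : Chain l C) where
    open Chain chain

    U-chain : ∀ {j k} → j ≤′ k → k ≤ l → ∀ H → T (U X (C k) H) → T (U X (C j) H)
    U-chain ≤′-refl            _   H H∈U = H∈U
    U-chain (≤′-step {k} j≤′k) k<l H H∈U =
      U-chain j≤′k (<⇒≤ k<l) H (U-antitone X (≤⇒covers X (Step.C≤C (steps k k<l))) H H∈U)

    L-chain : ∀ {j k} → j ≤′ k → k ≤ l → ∀ F → T (L X (C j) F) → T (L X (C k) F)
    L-chain ≤′-refl            _   F F∈L = F∈L
    L-chain (≤′-step {k} j≤′k) k<l F F∈L =
      L-monotone X (≤⇒downClause X (Step.C≤C (steps k k<l))) F (L-chain j≤′k (<⇒≤ k<l) F F∈L)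

    u v : ℕ → ℕ
    u j = count (U X (C j)) (allVec N)
    v j = count (L X (C (suc j))) (allVec N)

    potential : ℕ → ℕ
    potential j = u j + (Tn ∸ v j)

    potential< : ∀ j → potential j < suc (Tn + Tn)
    potential< j = s≤s (+-mono-≤ (count≤Tn _ (λ H → U-tab X (C j))) (m∸n≤m Tn (v j)))

    v≤Tn : ∀ j → v j ≤ Tn
    v≤Tn j = count≤Tn _ (λ F → L-tab X (C (suc j)))

    stable : ∀ {j k} → j ≤ k → k < l → potential j ≡ potential k →
             (∀ H → T (U X (C j) H) → T (U X (C k) H)) ×
             (∀ F → T (L X (C (suc k)) F) → T (L X (C (suc j)) F))
    stable {j} {k} j≤k k<l same =
      (λ H → count-stable Uk⊆Uj (allVec N) uj≤uk H (allVec-complete H)) ,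
      (λ F → count-stable Lj⊆Lk (allVec N) vk≤vj F (allVec-complete F))
      where
      Uk⊆Uj : ∀ H → T (U X (C k) H) → T (U X (C j) H)
      Uk⊆Uj = U-chain (≤⇒≤′ j≤k) (<⇒≤ k<l)
      Lj⊆Lk : ∀ F → T (L X (C (suc j)) F) → T (L X (C (suc k)) F)
      Lj⊆Lk = L-chain (≤⇒≤′ (s≤s j≤k)) k<l
      balanced : u j ≤ u k × Tn ∸ v j ≤ Tn ∸ v k
      balanced = sum-balanced (count-mono Uk⊆Uj (allVec N))
                              (∸-monoʳ-≤ Tn (count-mono Lj⊆Lk (allVec N))) same
      uj≤uk : u j ≤ u k
      uj≤uk = proj₁ balanced
      vk≤vj : v k ≤ v j
      vk≤vj = ∸-cancelʳ-≤ (v≤Tn k) (proj₂ balanced)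

    revisit : ∀ {j k} → j < k → k < l → potential j ≡ potential k → CLe X φ (C k) (C (suc j))
    revisit {j} {k} j<k k<l same = covers-downClause⇒≤ X covers downClause
      where
      stable-closures : (∀ H → T (U X (C j) H) → T (U X (C k) H)) ×
                        (∀ F → T (L X (C (suc k)) F) → T (L X (C (suc j)) F))
      stable-closures = stable (<⇒≤ j<k) k<l same
      covers : Covers X (C k) (C (suc j))
      covers = U⇒covered X λ G G∈C →
        proj₁ stable-closures G (covered⇒U X (≤⇒covers X (Step.C≤C (steps j (<-trans j<k k<l))))
                                   G G∈C (tableaux (suc j) (≤-trans j<k (<⇒≤ k<l)) G G∈C))
      downClause : DownClause X (C k) (C (suc j))
      downClause = downClause-transfer X (≤⇒downClause X (Step.C≤C (steps k k<l)))
                     (tableaux k (<⇒≤ k<l)) (proj₂ stable-closures)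

    signature : ∀ j → j < l → Fin ((suc (Tn + Tn) * N) * Tn)
    signature j j<l = combine (combine (fromℕ< (potential< j)) (index □χ∈sf))
                              (index (tab∈Tabs (tableaux j (<⇒≤ j<l) F F∈C)))
      where open Step (steps j j<l)

    signature-determines : ∀ {j k} (j<l : j < l) (k<l : k < l) → signature j j<l ≡ signature k k<l →
      potential j ≡ potential k × Step.χ (steps j j<l) ≡ Step.χ (steps k k<l) × Step.F (steps j j<l) ≡ Step.F (steps k k<l)
    signature-determines {j} {k} j<l k<l same with combine-injective _ _ _ _ same
    ... | same-first , same-F with combine-injective _ _ _ _ same-first
    ... | same-potential , same-box =
      trans (sym (toℕ-fromℕ< (potential< j))) (trans (cong toℕ same-potential) (toℕ-fromℕ< (potential< k))) ,
      □-injective (index-injective (Step.□χ∈sf (steps j j<l)) (Step.□χ∈sf (steps k k<l)) same-box) ,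
      index-injective _ _ same-F

    -- Two depths never share a signature: G_j would pass test (I) at depth k.
    no-repeat : ∀ {j k} (j<l : j < l) (k<l : k < l) → j < k → signature j j<l ≡ signature k k<l → ⊥
    no-repeat {j} {k} j<l k<l j<k same with signature-determines j<l k<l same
    ... | same-potential , same-χ , same-F =
      Step.testI-fails sk (suc j) j<k (revisit j<k k<l same-potential) (Step.G sj) (Step.G∈C sj)
        (subst (λ F → Prec X φ F (Step.G sj)) same-F (Step.F≼G sj))
        (subst (λ χ → ¬ (χ ∈[ φ ] Step.G sj)) same-χ (Step.χ∉G sj))
      where
      sj : Step C j
      sj = steps j j<l
      sk : Step C k
      sk = steps k k<l

    length-bound : l ≤ (suc (Tn + Tn) * N) * Tn
    length-bound = injective⇒≤ {f = code} code-injective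
      where
      code : Fin l → Fin ((suc (Tn + Tn) * N) * Tn)
      code i = signature (toℕ i) (toℕ<n i)
      code-injective : ∀ {i i'} → code i ≡ code i' → i ≡ i'
      code-injective {i} {i'} same with <-cmp (toℕ i) (toℕ i')
      ... | tri< i<i' _ _ = ⊥-elim (no-repeat _ _ i<i' same)
      ... | tri≈ _ i≡i' _ = toℕ-injective i≡i'
      ... | tri> _ _ i'<i = ⊥-elim (no-repeat _ _ i'<i (sym same))

-- A nonempty vector read as a sequence indexed by ℕ (constant after the last entry),
-- and how this reading interacts with lookup, last and appending.
at : ∀ {A : Set} {n} → Vec A (suc n) → ℕ → A
at (x ∷ [])     _       = x
at (x ∷ y ∷ xs) zero    = x
at (x ∷ y ∷ xs) (suc i) = at (y ∷ xs) i

at-lookup : ∀ {A : Set} {n} (s : Vec A (suc n)) (i : Fin (suc n)) → lookup s i ≡ at s (toℕ i)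
at-lookup (x ∷ [])     Fin.zero    = refl
at-lookup (x ∷ y ∷ xs) Fin.zero    = refl
at-lookup (x ∷ y ∷ xs) (Fin.suc i) = at-lookup (y ∷ xs) i

at-last : ∀ {A : Set} {n} (s : Vec A (suc n)) → last s ≡ at s n
at-last (x ∷ [])     = refl
at-last (x ∷ y ∷ xs) = at-last (y ∷ xs)

at-∷ʳ-old : ∀ {A : Set} {n} (s : Vec A (suc n)) x i → i ≤ n → at (s ∷ʳ x) i ≡ at s i
at-∷ʳ-old (y ∷ [])     x zero    _         = refl
at-∷ʳ-old (y ∷ z ∷ zs) x zero    _         = refl
at-∷ʳ-old (y ∷ z ∷ zs) x (suc i) (s≤s i≤n) = at-∷ʳ-old (z ∷ zs) x i i≤n

at-∷ʳ-new : ∀ {A : Set} {n} (s : Vec A (suc n)) x → at (s ∷ʳ x) (suc n) ≡ x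
at-∷ʳ-new (y ∷ [])     x = refl
at-∷ʳ-new (y ∷ z ∷ zs) x = at-∷ʳ-new (z ∷ zs) x

module Extraction (X : Logic) (φ : Fm) where
  open Closures φ
  open Chains X φ

  move : ∀ {𝓐 𝓑 : Cloud φ} → 𝓐 ≡ 𝓑 → ∀ {F} → F ∈ᶜ[ φ ] 𝓐 → F ∈ᶜ[ φ ] 𝓑
  move refl F∈𝓐 = F∈𝓐

  Step-agree : ∀ {C C' : ℕ → Cloud φ} j → (∀ i → i ≤ suc j → C i ≡ C' i) → Step C j → Step C' j
  Step-agree {C} {C'} j agree s = record
    { χ = χ ; F = F ; G = G ; □χ∈sf = □χ∈sf
    ; F∈C = move Cj≡ F∈C
    ; testI-fails = λ i i≤j C'j≤C'i G' G'∈C'i →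
        testI-fails i i≤j (subst₂ (CLe X φ) (sym Cj≡) (sym (Ci≡ i i≤j)) C'j≤C'i)
                    G' (move (sym (Ci≡ i i≤j)) G'∈C'i)
    ; C≤C = subst₂ (CLe X φ) Cj≡ Csj≡ C≤C
    ; G∈C = move Csj≡ G∈C ; F≼G = F≼G ; χ∉G = χ∉G }
    where
    open Step s
    Ci≡ : ∀ i → i ≤ j → C i ≡ C' i
    Ci≡ i i≤j = agree i (m≤n⇒m≤1+n i≤j)
    Cj≡ : C j ≡ C' j
    Cj≡ = Ci≡ j ≤-refl
    Csj≡ : C (suc j) ≡ C' (suc j)
    Csj≡ = agree (suc j) ≤-refl

  extract : ∀ {l s} → AlgCall X φ l s → Chain l (at s)
  extract (start 𝓕₀ 𝓕₀-cloud (F , F∈𝓕₀ , _)) = record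
    { tableaux = λ _ _ → proj₁ 𝓕₀-cloud ; initial = F , F∈𝓕₀ ; steps = λ _ () }
  extract {suc m} (step s call χ F □χ∈sf F∈last _ testI-fails 𝓕' 𝓕'-cloud _ last≤𝓕'
                          (G , G∈𝓕' , F≼G , χ∉G)) = record
    { tableaux = tableaux'
    ; initial = proj₁ initial , move (sym (old zero z≤n)) (proj₂ initial)
    ; steps = steps' }
    where
    open Chain (extract call)
    C' : ℕ → Cloud φ
    C' = at (s ∷ʳ 𝓕')
    old : ∀ i → i ≤ m → C' i ≡ at s i
    old = at-∷ʳ-old s 𝓕'
    new : C' (suc m) ≡ 𝓕'
    new = at-∷ʳ-new s 𝓕'
    last≡ : last s ≡ C' m
    last≡ = trans (at-last s) (sym (old m ≤-refl))
    tableaux' : ∀ i → i ≤ suc m → ∀ H → H ∈ᶜ[ φ ] C' i → IsTab X φ H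
    tableaux' i i≤sm H H∈C'i with m≤n⇒m<n∨m≡n i≤sm
    ... | inj₁ i<sm = tableaux i (s≤s⁻¹ i<sm) H (move (old i (s≤s⁻¹ i<sm)) H∈C'i)
    ... | inj₂ refl = proj₁ 𝓕'-cloud H (move new H∈C'i)
    C'≡lookup : ∀ i (i≤m : i ≤ m) → C' i ≡ lookup s (fromℕ< (s≤s i≤m))
    C'≡lookup i i≤m = begin
      C' i                            ≡⟨ old i i≤m ⟩
      at s i                          ≡⟨ cong (at s) (toℕ-fromℕ< (s≤s i≤m)) ⟨
      at s (toℕ (fromℕ< (s≤s i≤m)))   ≡⟨ at-lookup s (fromℕ< (s≤s i≤m)) ⟨
      lookup s (fromℕ< (s≤s i≤m))     ∎
      where open ≡-Reasoning
    newest : Step C' m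
    newest = record
      { χ = χ ; F = F ; G = G ; □χ∈sf = □χ∈sf
      ; F∈C = move last≡ F∈last
      ; testI-fails = λ i i≤m C'm≤C'i G' G'∈C'i G'-fits χ∉G' →
          testI-fails (fromℕ< (s≤s i≤m) , subst₂ (CLe X φ) (sym last≡) (C'≡lookup i i≤m) C'm≤C'i ,
                       G' , move (C'≡lookup i i≤m) G'∈C'i , G'-fits , χ∉G')
      ; C≤C = subst₂ (CLe X φ) last≡ (sym new) last≤𝓕'
      ; G∈C = move (sym new) G∈𝓕' ; F≼G = F≼G ; χ∉G = χ∉G }
    steps' : ∀ j → j < suc m → Step C' j
    steps' j j<sm with m≤n⇒m<n∨m≡n (s≤s⁻¹ j<sm)
    ... | inj₁ j<m = Step-agree j (λ i i≤sj → sym (old i (≤-trans i≤sj j<m))) (steps j j<m)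
    ... | inj₂ refl = newest

final-bound : ∀ {l N n T} → l ≤ suc (T + T) * N * T → N ≤ n → 1 ≤ n → 1 ≤ T → l < 5 * n * T ^ 2
final-bound {l} {N} {n} {T} l≤ N≤n 1≤n 1≤T = begin-strict
  l                     ≤⟨ l≤ ⟩
  suc (T + T) * N * T   ≤⟨ *-monoˡ-≤ T (*-mono-≤ (+-monoˡ-≤ (T + T) 1≤T) N≤n) ⟩
  (T + (T + T)) * n * T ≡⟨ regroup n T ⟩
  3 * x                 <⟨ m<m+n (3 * x) (≤-trans 1≤x (m≤m+n x (x + 0))) ⟩
  3 * x + 2 * x         ≡⟨ regroup′ n T ⟩
  5 * n * T ^ 2         ∎
  where
  open ≤-Reasoning
  x : ℕ
  x = n * T ^ 2
  1≤x : 1 ≤ x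
  1≤x = *-mono-≤ 1≤n (*-mono-≤ 1≤T (*-mono-≤ 1≤T ≤-refl))
  -- T ^ 2 unfolds to T * (T * 1); the ring solver does not handle _^_
  regroup : ∀ n T → (T + (T + T)) * n * T ≡ 3 * (n * (T * (T * 1)))
  regroup = solve-∀
  regroup′ : ∀ n T → 3 * (n * (T * (T * 1))) + 2 * (n * (T * (T * 1))) ≡ 5 * n * (T * (T * 1))
  regroup′ = solve-∀

-- N ≤ n: sfRaw lists one subformula per occurrence of ¬, ∧, K, □ or a variable.
sfRaw-length : ∀ φ → length (sfRaw φ) ≤ len φ
sfRaw-length (var a)  = s≤s z≤n
sfRaw-length (¬' a)   = s≤s (sfRaw-length a)
sfRaw-length (K a)    = s≤s (sfRaw-length a)
sfRaw-length (□ a)    = s≤s (sfRaw-length a)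
sfRaw-length (a ∧' b) = s≤s (begin
  length (sfRaw a ++ sfRaw b)         ≡⟨ length-++ (sfRaw a) ⟩
  length (sfRaw a) + length (sfRaw b) ≤⟨ +-mono-≤ (sfRaw-length a) (sfRaw-length b) ⟩
  len a + len b                       ≤⟨ m≤n+m (len a + len b) 2 ⟩
  2 + len a + len b                   ∎)
  where open ≤-Reasoning

sf-length : ∀ φ → length (sf φ) ≤ len φ
sf-length φ = ≤-trans (length-deduplicate _ (sfRaw φ)) (sfRaw-length φ)

len-positive : ∀ φ → 1 ≤ len φ
len-positive (var a)  = s≤s z≤n
len-positive (¬' a)   = s≤s z≤n
len-positive (a ∧' b) = s≤s z≤n
len-positive (K a)    = s≤s z≤n
len-positive (□ a)    = s≤s z≤n

proposition8p3 : (X : Logic) (φ : Fm) (l : ℕ) (s : Vec (Cloud φ) (suc l)) →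
    AlgCall X φ l s → l < 5 * len φ * numTab X φ ^ 2
proposition8p3 X φ l s call =
  final-bound length-bound (sf-length φ) (len-positive φ) numTab-positive
  where
  open Chains X φ
  chain : Chain l (at s)
  chain = Extraction.extract X φ call
  open Chain chain using (tableaux; initial)
  open Bound chain using (length-bound)
  numTab-positive : 1 ≤ numTab X φ
  numTab-positive = ∈-length (tab∈Tabs (tableaux 0 z≤n (proj₁ initial) (proj₂ initial)))
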